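{- Assume the setting below, and that $Q(X)\neq\emptyset$ for every object $X$ of $\mathsf{C}$. Then $(0,\omega)$ is a dualizing object of $\int Q$ if and only if $0$ is a dualizing object of $\mathsf{C}$ and, for every object $X$ of $\mathsf{C}$, $Q(j_X)=\omega_{X^{*}}\circ\omega_X$ as maps $Q(X)\to Q(X^{**})$.
   Context: $(\mathsf{C},\otimes,I,a,\lambda,\rho,\sigma)$ is symmetric monoidal closed with internal hom $\multimap$, unit $\eta_{X,Y}$, counit $\mathrm{ev}_{X,Y}:X\otimes(X\multimap Y)\to Y$. $Q:\mathsf{C}\to\mathsf{Pos}$ is a functor with $u\in Q(I)$ and monotone lax natural maps $\mu_{X,Y}:Q(X)\times Q(Y)\to Q(X\otimes Y)$ satisfying $Q(\lambda_Y)(\mu_{I,Y}(u,y))=y$, $Q(\rho_X)(\mu_{X,I}(x,u))=x$, $Q(a)(\mu(\mu(x,y),z))=\mu(x,\mu(y,z))$, $Q(\sigma_{X,Y})(\mu_{X,Y}(x,y))=\mu_{Y,X}(y,x)$. $\int Q$ has objects $(X,x)$, $x\in Q(X)$, and arrows $f:(X,x)\to(Y,y)$ with $Q(f)(x)\le y$; it is symmetric monoidal via $(X,x)\otimes(Y,y)=(X\otimes Y,\mu(x,y))$, unit $(I,u)$. Put $\langle x,b\rangle_{X,Y}:=Q(\mathrm{ev}_{X,Y})(\mu_{X,X\multimap Y}(x,b))$. Assume $\mu_{X,Y}(x,y)=\langle x,Q(\eta_{X,Y})(y)\rangle_{X,X\otimes Y}$ and that each $\langle\alpha,-\rangle_{X,Y}$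 has a right adjoint $\iota_{X,Y}(\alpha,-)$; then $\int Q$ is symmetric monoidal closed with $(X,\alpha)\multimap(Y,\beta)=(X\multimap Y,\iota_{X,Y}(\alpha,\beta))$ and unit/counit those of $\mathsf{C}$. Fix an object $0$ of $\mathsf{C}$ and $\omega\in Q(0)$; $X^*:=X\multimap0$, $\omega_X(\alpha):=\iota_{X,0}(\alpha,\omega)$. In a symmetric monoidal closed category an object $0$ is dualizing if for every $X$ the canonical arrow $j_X:X\to(X\multimap0)\multimap0$ (transpose of $\mathrm{ev}_{X,0}\circ\sigma$) is invertible. In $\int Q$, the canonical arrow for $(0,\omega)$ at $(X,\alpha)$ is $j_X:(X,\alpha)\to(X^{**},\omega_{X^*}(\omega_X(\alpha)))$. -}

module Defs where

open import Level using (Level; _⊔_) renaming (suc to lsuc)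
open import Data.Product using (Σ; _×_; _,_; proj₁; proj₂)
open import Relation.Binary.Structures using (IsEquivalence)
open import Relation.Binary.Bundles using (Poset)

record Category (o ℓ e : Level) : Set (lsuc (o ⊔ ℓ ⊔ e)) where
  infixr 9 _∘_
  infix 4 _≈_
  field
    Obj : Set o
    _⇒_ : Obj → Obj → Set ℓ
    _≈_ : ∀ {A B} → A ⇒ B → A ⇒ B → Set e
    id : ∀ {A} → A ⇒ A
    _∘_ : ∀ {A B C} → B ⇒ C → A ⇒ B → A ⇒ C
    ≈-equiv : ∀ {A B} → IsEquivalence (_≈_ {A} {B})
    assoc : ∀ {A B C D} {f : A ⇒ B} {g : B ⇒ C} {h : C ⇒ D} →
            (h ∘ g) ∘ f ≈ h ∘ (g ∘ f)
    identityˡ : ∀ {A B} {f : A ⇒ B} → id ∘ f ≈ f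
    identityʳ : ∀ {A B} {f : A ⇒ B} → f ∘ id ≈ f
    ∘-resp-≈ : ∀ {A B C} {f h : B ⇒ C} {g i : A ⇒ B} →
               f ≈ h → g ≈ i → f ∘ g ≈ h ∘ i

IsIso : ∀ {o ℓ e} (C : Category o ℓ e) {A B : Category.Obj C} →
        Category._⇒_ C A B → Set (ℓ ⊔ e)
IsIso C {A} {B} f =
  Σ (B ⇒ A) λ g → (g ∘ f ≈ id) × (f ∘ g ≈ id)
  where open Category C

record SymmetricMonoidalClosed {o ℓ e : Level} (C : Category o ℓ e)
       : Set (o ⊔ ℓ ⊔ e) where
  open Category C
  infixr 10 _⊗₀_ _⊗₁_
  infixr 5 _⊸_
  field
    _⊗₀_ : Obj → Obj → Obj
    _⊗₁_ : ∀ {A B C D} → A ⇒ B → C ⇒ D → (A ⊗₀ C) ⇒ (B ⊗₀ D)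
    ⊗-id : ∀ {A B} → id {A} ⊗₁ id {B} ≈ id
    ⊗-∘ : ∀ {A B C D E F} {f : B ⇒ C} {g : A ⇒ B} {h : E ⇒ F} {k : D ⇒ E} →
          (f ∘ g) ⊗₁ (h ∘ k) ≈ (f ⊗₁ h) ∘ (g ⊗₁ k)
    ⊗-resp-≈ : ∀ {A B C D} {f f' : A ⇒ B} {g g' : C ⇒ D} →
               f ≈ f' → g ≈ g' → f ⊗₁ g ≈ f' ⊗₁ g'
    unit : Obj
    a⇒ : ∀ {A B C} → ((A ⊗₀ B) ⊗₀ C) ⇒ (A ⊗₀ (B ⊗₀ C))
    a⇐ : ∀ {A B C} → (A ⊗₀ (B ⊗₀ C)) ⇒ ((A ⊗₀ B) ⊗₀ C)
    a-isoˡ : ∀ {A B C} → a⇐ ∘ a⇒ {A} {B} {C} ≈ id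
    a-isoʳ : ∀ {A B C} → a⇒ ∘ a⇐ {A} {B} {C} ≈ id
    a-natural : ∀ {A B C A' B' C'} {f : A ⇒ A'} {g : B ⇒ B'} {h : C ⇒ C'} →
                a⇒ ∘ ((f ⊗₁ g) ⊗₁ h) ≈ (f ⊗₁ (g ⊗₁ h)) ∘ a⇒
    λ⇒ : ∀ {A} → (unit ⊗₀ A) ⇒ A
    λ⇐ : ∀ {A} → A ⇒ (unit ⊗₀ A)
    λ-isoˡ : ∀ {A} → λ⇐ ∘ λ⇒ {A} ≈ id
    λ-isoʳ : ∀ {A} → λ⇒ ∘ λ⇐ {A} ≈ id
    λ-natural : ∀ {A B} {f : A ⇒ B} → λ⇒ ∘ (id ⊗₁ f) ≈ f ∘ λ⇒
    ρ⇒ : ∀ {A} → (A ⊗₀ unit) ⇒ A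
    ρ⇐ : ∀ {A} → A ⇒ (A ⊗₀ unit)
    ρ-isoˡ : ∀ {A} → ρ⇐ ∘ ρ⇒ {A} ≈ id
    ρ-isoʳ : ∀ {A} → ρ⇒ ∘ ρ⇐ {A} ≈ id
    ρ-natural : ∀ {A B} {f : A ⇒ B} → ρ⇒ ∘ (f ⊗₁ id) ≈ f ∘ ρ⇒
    σ : ∀ {A B} → (A ⊗₀ B) ⇒ (B ⊗₀ A)
    σ-natural : ∀ {A B C D} {f : A ⇒ B} {g : C ⇒ D} →
                σ ∘ (f ⊗₁ g) ≈ (g ⊗₁ f) ∘ σ
    σ-involutive : ∀ {A B} → σ {B} {A} ∘ σ {A} {B} ≈ id
    pentagon : ∀ {A B C D} →
      (id {A} ⊗₁ a⇒ {B} {C} {D}) ∘ a⇒ ∘ (a⇒ ⊗₁ id) ≈ a⇒ ∘ a⇒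
    triangle : ∀ {A B} → (id {A} ⊗₁ λ⇒ {B}) ∘ a⇒ ≈ ρ⇒ ⊗₁ id
    hexagon : ∀ {A B C} →
      a⇒ {B} {C} {A} ∘ σ ∘ a⇒ ≈ (id ⊗₁ σ) ∘ a⇒ ∘ (σ ⊗₁ id)
    _⊸_ : Obj → Obj → Obj
    ev : ∀ {X Y} → (X ⊗₀ (X ⊸ Y)) ⇒ Y
    curry : ∀ {X Y Z} → (X ⊗₀ Z) ⇒ Y → Z ⇒ (X ⊸ Y)
    ev-curry : ∀ {X Y Z} {f : (X ⊗₀ Z) ⇒ Y} → ev ∘ (id ⊗₁ curry f) ≈ f
    curry-unique : ∀ {X Y Z} {f : (X ⊗₀ Z) ⇒ Y} {g : Z ⇒ (X ⊸ Y)} →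
                   ev ∘ (id ⊗₁ g) ≈ f → g ≈ curry f

  η : ∀ X Y → Y ⇒ (X ⊸ (X ⊗₀ Y))
  η X Y = curry id

  j : ∀ (O X : Obj) → X ⇒ ((X ⊸ O) ⊸ O)
  j O X = curry (ev {X} {O} ∘ σ)

  Dualizing : Obj → Set (o ⊔ ℓ ⊔ e)
  Dualizing O = ∀ X → IsIso C (j O X)

record LaxMonoidalPosFunctor {o ℓ e : Level} {C : Category o ℓ e}
       (M : SymmetricMonoidalClosed C) (c₁ c₂ c₃ : Level)
       : Set (o ⊔ ℓ ⊔ e ⊔ lsuc (c₁ ⊔ c₂ ⊔ c₃)) where
  open Category C
  open SymmetricMonoidalClosed M
  field
    Q₀ : Obj → Poset c₁ c₂ c₃
  ∣_∣ : Obj → Set c₁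
  ∣ X ∣ = Poset.Carrier (Q₀ X)
  Le : ∀ X → ∣ X ∣ → ∣ X ∣ → Set c₃
  Le X = Poset._≤_ (Q₀ X)
  Eq : ∀ X → ∣ X ∣ → ∣ X ∣ → Set c₂
  Eq X = Poset._≈_ (Q₀ X)
  syntax Le X x y = x ≤[ X ] y
  syntax Eq X x y = x ≈[ X ] y
  field
    Q₁ : ∀ {X Y} → X ⇒ Y → ∣ X ∣ → ∣ Y ∣
    Q₁-mono : ∀ {X Y} (f : X ⇒ Y) {x x'} → x ≤[ X ] x' → Q₁ f x ≤[ Y ] Q₁ f x'
    Q₁-resp-≈ : ∀ {X Y} {f g : X ⇒ Y} → f ≈ g → ∀ x → Q₁ f x ≈[ Y ] Q₁ g x
    Q-id : ∀ {X} (x : ∣ X ∣) → Q₁ id x ≈[ X ] x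
    Q-∘ : ∀ {X Y Z} (g : Y ⇒ Z) (f : X ⇒ Y) (x : ∣ X ∣) →
          Q₁ (g ∘ f) x ≈[ Z ] Q₁ g (Q₁ f x)
    u : ∣ unit ∣
    μ : ∀ {X Y} → ∣ X ∣ → ∣ Y ∣ → ∣ X ⊗₀ Y ∣
    μ-mono : ∀ {X Y} {x x' : ∣ X ∣} {y y' : ∣ Y ∣} →
             x ≤[ X ] x' → y ≤[ Y ] y' → μ x y ≤[ X ⊗₀ Y ] μ x' y'
    μ-lax : ∀ {X X' Y Y'} (f : X ⇒ X') (g : Y ⇒ Y') (x : ∣ X ∣) (y : ∣ Y ∣) →
            Q₁ (f ⊗₁ g) (μ x y) ≤[ X' ⊗₀ Y' ] μ (Q₁ f x) (Q₁ g y)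
    μ-λ : ∀ {Y} (y : ∣ Y ∣) → Q₁ λ⇒ (μ u y) ≈[ Y ] y
    μ-ρ : ∀ {X} (x : ∣ X ∣) → Q₁ ρ⇒ (μ x u) ≈[ X ] x
    μ-a : ∀ {X Y Z} (x : ∣ X ∣) (y : ∣ Y ∣) (z : ∣ Z ∣) →
          Q₁ a⇒ (μ (μ x y) z) ≈[ X ⊗₀ (Y ⊗₀ Z) ] μ x (μ y z)
    μ-σ : ∀ {X Y} (x : ∣ X ∣) (y : ∣ Y ∣) →
          Q₁ σ (μ x y) ≈[ Y ⊗₀ X ] μ y x

  ⟨_,_⟩ : ∀ {X Y} → ∣ X ∣ → ∣ X ⊸ Y ∣ → ∣ Y ∣
  ⟨ x , b ⟩ = Q₁ ev (μ x b)

record ClosednessAssumptions {o ℓ e c₁ c₂ c₃ : Level} {C : Category o ℓ e}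
       {M : SymmetricMonoidalClosed C} (Q : LaxMonoidalPosFunctor M c₁ c₂ c₃)
       : Set (o ⊔ c₁ ⊔ c₂ ⊔ c₃) where
  open Category C
  open SymmetricMonoidalClosed M
  open LaxMonoidalPosFunctor Q
  field
    μ-pairing : ∀ {X Y} (x : ∣ X ∣) (y : ∣ Y ∣) →
                μ x y ≈[ X ⊗₀ Y ] ⟨ x , Q₁ (η X Y) y ⟩
    ι : ∀ {X Y} → ∣ X ∣ → ∣ Y ∣ → ∣ X ⊸ Y ∣
    ι-mono : ∀ {X Y} (α : ∣ X ∣) {β β' : ∣ Y ∣} →
             β ≤[ Y ] β' → ι α β ≤[ X ⊸ Y ] ι α β'
    adj⇒ : ∀ {X Y} (α : ∣ X ∣) (b : ∣ X ⊸ Y ∣) (β : ∣ Y ∣) →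
           ⟨ α , b ⟩ ≤[ Y ] β → b ≤[ X ⊸ Y ] ι α β
    adj⇐ : ∀ {X Y} (α : ∣ X ∣) (b : ∣ X ⊸ Y ∣) (β : ∣ Y ∣) →
           b ≤[ X ⊸ Y ] ι α β → ⟨ α , b ⟩ ≤[ Y ] β

module _ {o ℓ e c₁ c₂ c₃ : Level} {C : Category o ℓ e}
         {M : SymmetricMonoidalClosed C} (Q : LaxMonoidalPosFunctor M c₁ c₂ c₃) where
  open Category C
  open LaxMonoidalPosFunctor Q

  private
    module P X = Poset (Q₀ X)

  ∫ : Category (o ⊔ c₁) (ℓ ⊔ c₃) e
  ∫ = record
    { Obj = Σ Obj ∣_∣
    ; _⇒_ = λ { (X , x) (Y , y) → Σ (X ⇒ Y) λ f → Q₁ f x ≤[ Y ] y }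
    ; _≈_ = λ f g → proj₁ f ≈ proj₁ g
    ; id = λ { {X , x} → id , P.reflexive X (Q-id x) }
    ; _∘_ = λ { {X , x} {Y , y} {Z , z} (g , p) (f , q) →
               g ∘ f ,
               P.trans Z (P.reflexive Z (Q-∘ g f x))
                 (P.trans Z (Q₁-mono g q) p) }
    ; ≈-equiv = record { refl = IsEquivalence.refl ≈-equiv
                       ; sym = IsEquivalence.sym ≈-equiv
                       ; trans = IsEquivalence.trans ≈-equiv }
    ; assoc = assoc
    ; identityˡ = identityˡ
    ; identityʳ = identityʳ
    ; ∘-resp-≈ = ∘-resp-≈
    }

module _ {o ℓ e c₁ c₂ c₃ : Level} {C : Category o ℓ e}
         {M : SymmetricMonoidalClosed C} {Q : LaxMonoidalPosFunctor M c₁ c₂ c₃}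
         (K : ClosednessAssumptions Q) where
  open Category C
  open SymmetricMonoidalClosed M
  open LaxMonoidalPosFunctor Q
  open ClosednessAssumptions K

  ω[_] : ∀ {O} (ω : ∣ O ∣) (X : Obj) → ∣ X ∣ → ∣ X ⊸ O ∣
  ω[ ω ] X α = ι α ω

  Dualizing∫ : (O : Obj) → ∣ O ∣ → Set (o ⊔ ℓ ⊔ e ⊔ c₁ ⊔ c₃)
  Dualizing∫ O ω =
    ∀ (X : Obj) (α : ∣ X ∣) →
      Σ (Q₁ (j O X) α ≤[ (X ⊸ O) ⊸ O ] ω[ ω ] (X ⊸ O) (ω[ ω ] X α))
        λ isArrow → IsIso (∫ Q) {X , α} {(X ⊸ O) ⊸ O , ω[ ω ] (X ⊸ O) (ω[ ω ] X α)}
                      (j O X , isArrow)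

{-# OPTIONS --safe #-}
-- An arrow (f , p) : (X , α) → (Y , β) of ∫Q is invertible exactly when f is
-- invertible in C and Q(f)(α) = β: an inverse g with Q(g)(β) ≤ α gives
-- β = Q(f)(Q(g)(β)) ≤ Q(f)(α) ≤ β.  Applied to the canonical arrows j_X this
-- splits dualizing-ness of (0 , ω) into dualizing-ness of 0 and the equation
-- Q(j_X) = ω_{X*} ∘ ω_X; an element of Q(X) is needed to see that j_X itself
-- is invertible.
module Submission where

open import Defs
open import Level using (Level)
open import Data.Product using (Σ; _×_; _,_; proj₁; proj₂)
open import Function.Bundles using (_⇔_; mk⇔; Equivalence)
open import Relation.Binary.Bundles using (Poset)
import Relation.Binary.Reasoning.PartialOrder as PosetReasoning

module _ {o ℓ e c₁ c₂ c₃ : Level} {C : Category o ℓ e}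
         {M : SymmetricMonoidalClosed C} (Q : LaxMonoidalPosFunctor M c₁ c₂ c₃) where
  open Category C
  open LaxMonoidalPosFunctor Q

  private
    module P X = Poset (Q₀ X)

  Q₁-section : ∀ {X Y} {f : X ⇒ Y} {g : Y ⇒ X} → f ∘ g ≈ id →
               ∀ y → Q₁ f (Q₁ g y) ≈[ Y ] y
  Q₁-section {Y = Y} {f} {g} f∘g≈id y = begin-equality
    Q₁ f (Q₁ g y)  ≈⟨ Q-∘ f g y ⟨
    Q₁ (f ∘ g) y   ≈⟨ Q₁-resp-≈ f∘g≈id y ⟩
    Q₁ id y        ≈⟨ Q-id y ⟩
    y              ∎
    where open PosetReasoning (Q₀ Y)

  ∫-iso⇔iso×Q₁≈ : ∀ {X Y α β} (f : X ⇒ Y) →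
    Σ (Q₁ f α ≤[ Y ] β) (λ p → IsIso (∫ Q) {X , α} {Y , β} (f , p))
      ⇔ (IsIso C f × Q₁ f α ≈[ Y ] β)
  ∫-iso⇔iso×Q₁≈ {X} {Y} {α} {β} f = mk⇔ to from
    where
    to : Σ (Q₁ f α ≤[ Y ] β) (λ p → IsIso (∫ Q) (f , p)) → IsIso C f × Q₁ f α ≈[ Y ] β
    to (p , (g , Qgβ≤α) , g∘f≈id , f∘g≈id) = (g , g∘f≈id , f∘g≈id) , P.antisym Y p β≤Qfα
      where
      open PosetReasoning (Q₀ Y)
      β≤Qfα : β ≤[ Y ] Q₁ f α
      β≤Qfα = begin
        β              ≈⟨ Q₁-section f∘g≈id β ⟨
        Q₁ f (Q₁ g β)  ≤⟨ Q₁-mono f Qgβ≤α ⟩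
        Q₁ f α         ∎

    from : IsIso C f × Q₁ f α ≈[ Y ] β → Σ (Q₁ f α ≤[ Y ] β) (λ p → IsIso (∫ Q) (f , p))
    from ((g , g∘f≈id , f∘g≈id) , Qfα≈β) =
      P.reflexive Y Qfα≈β , (g , Qgβ≤α) , g∘f≈id , f∘g≈id
      where
      open PosetReasoning (Q₀ X)
      Qgβ≤α : Q₁ g β ≤[ X ] α
      Qgβ≤α = begin
        Q₁ g β         ≤⟨ Q₁-mono g (P.reflexive Y (P.Eq.sym Y Qfα≈β)) ⟩
        Q₁ g (Q₁ f α)  ≈⟨ Q₁-section g∘f≈id α ⟩
        α              ∎

mainTheorem7 : ∀ {o ℓ e c₁ c₂ c₃ : Level}
    (C : Category o ℓ e) (M : SymmetricMonoidalClosed C)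
    (Q : LaxMonoidalPosFunctor M c₁ c₂ c₃) (K : ClosednessAssumptions Q)
    (nonempty : ∀ X → Poset.Carrier (LaxMonoidalPosFunctor.Q₀ Q X))
    (O : Category.Obj C) (ω : Poset.Carrier (LaxMonoidalPosFunctor.Q₀ Q O)) →
    Dualizing∫ K O ω
      ⇔ (SymmetricMonoidalClosed.Dualizing M O
         × (∀ X α → Poset._≈_ (LaxMonoidalPosFunctor.Q₀ Q (SymmetricMonoidalClosed._⊸_ M (SymmetricMonoidalClosed._⊸_ M X O) O))
              (LaxMonoidalPosFunctor.Q₁ Q (SymmetricMonoidalClosed.j M O X) α)
              (ω[_] K ω (SymmetricMonoidalClosed._⊸_ M X O) (ω[_] K ω X α))))
mainTheorem7 C M Q K nonempty O ω = mk⇔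
  (λ dual∫ → (λ X → proj₁ (to X (dual∫ X (nonempty X))))
           , (λ X α → proj₂ (to X (dual∫ X α))))
  (λ (dual , jX≈ω²) X α → from X (dual X , jX≈ω² X α))
  where
  open SymmetricMonoidalClosed M using (j)
  module ∫-iso X {α} = Equivalence (∫-iso⇔iso×Q₁≈ Q {α = α} (j O X))
  open ∫-iso using (to; from)
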